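{- Let $m\ge1$, $n\ge0$. The set of rules $\mathcal{O}^m_n\cup\{\frac{}{\top}\}$ axiomatizes $\vdash^{\leq}_{\mathbb{O}^m_n}$, i.e., $\vdash_{\mathcal{O}^m_n\cup\{\frac{}{\top}\}}=\vdash^{\leq}_{\mathbb{O}^m_n}$.
   Context: Language: binary $\land,\lor$, unary $\neg$, constants $\bot,\top$; $Fm$ is the set of formulas over a countably infinite set of variables; $\neg^0\varphi=\varphi$, $\neg^{k+1}\varphi=\neg\neg^k\varphi$. An Ockham algebra is an algebra $\langle A;\land,\lor,\neg,\bot,\top\rangle$ with bounded distributive lattice reduct satisfying $\neg\bot\approx\top$, $\neg(x\lor y)\approx\neg x\land\neg y$, $\neg\top\approx\bot$, $\neg(x\land y)\approx\neg x\lor\neg y$; the Berman variety $\mathbb{O}^m_n$ consists of Ockham algebras satisfying $\neg^{2m+n}x\approx\neg^nx$. $\Gamma\vdash^{\leq}_{\mathbb{O}^m_n}\varphi$ iff for every $\mathbf{A}\in\mathbb{O}^m_n$, every non-empty lattice filter $F$ of $\mathbf{A}$ and every homomorphism $h\colon Fm\to A$, $h[\Gamma]\subseteq F$ implies $h(\varphi)\in F$. $\vdash_{\mathcal{R}}$ denotes Hilbert derivability with substitution instances of rules in $\mathcal{R}$. Let $\mathsf{Eq}^m_n$ be: the bounded distributive lattice axioms ($x\lor y\approx y\lor x$, $x\land y\approx y\land x$, $x\lor(y\lor z)\approx(x\lor y)\lor z$, $x\land(y\land z)\approx(x\land y)\land z$, $x\lor x\approx x$, $x\land x\approx x$, $x\lor(x\land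 y)\approx x$, $x\land(x\lor y)\approx x$, $x\land\bot\approx\bot$, $x\lor\top\approx\top$, $x\land(y\lor z)\approx(x\land y)\lor(x\land z)$), $\neg\bot\approx\top$, $\neg(x\lor y)\approx\neg x\land\neg y$, $\neg\top\approx\bot$, $\neg(x\land y)\approx\neg x\lor\neg y$, $\neg^{2m+n}x\approx\neg^nx$. Let $\mathcal{R}^{\mathsf{Eq}^m_n}=\{\frac{\varphi}{\psi},\frac{\psi}{\varphi}:\varphi\approx\psi\in\mathsf{Eq}^m_n\}$, $\mathcal{R}^{mn}_\land=\mathcal{R}^{\mathsf{Eq}^m_n}\cup\{\frac{p\land q}{p},\frac{p\land q}{q}\}$. For a rule $\mathsf{r}=\frac{\varphi}{\psi}$, fresh variable $t$, and $k<\omega$: $\mathsf{s}_k(\mathsf{r})=\frac{\neg^k\varphi\lor t}{\neg^k\psi\lor t}$ for even $k$, $\mathsf{s}_k(\mathsf{r})=\frac{\neg^k\psi\lor t}{\neg^k\varphi\lor t}$ for odd $k$. $\mathcal{O}^m_n=\mathcal{R}^{mn}_\land\cup\{\mathsf{s}_i(\mathsf{r}):i\le2m+n,\ \mathsf{r}\in\mathcal{R}^{mn}_\land\}\cup\{\frac{p\,,\,q}{p\land q}\}$. -}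

module Defs where

open import Level using (Level; suc; _⊔_) renaming (zero to lzero)
open import Data.Nat using (ℕ; zero; suc; _+_; _*_; _≤_)
open import Data.Fin using (Fin) renaming (zero to fzero; suc to fsuc)
open import Data.Bool using (Bool; true; false; if_then_else_)
open import Data.Product using (Σ; ∃; _×_)
open import Data.Sum using (_⊎_)
open import Relation.Binary.PropositionalEquality using (_≡_)
open import Relation.Binary.Structures using (IsEquivalence)

infixr 6 _∧_
infixr 5 _∨_
infix 7 ¬_

data Fm : Set where
  var : ℕ → Fm
  _∧_ : Fm → Fm → Fm
  _∨_ : Fm → Fm → Fm
  ¬_  : Fm → Fm
  ⊥ᶠ  : Fm
  ⊤ᶠ  : Fm

¬^ : ℕ → Fm → Fm
¬^ zero    φ = φ
¬^ (suc k) φ = ¬ (¬^ k φ)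

sub : (ℕ → Fm) → Fm → Fm
sub σ (var x) = σ x
sub σ (φ ∧ ψ) = sub σ φ ∧ sub σ ψ
sub σ (φ ∨ ψ) = sub σ φ ∨ sub σ ψ
sub σ (¬ φ)   = ¬ sub σ φ
sub σ ⊥ᶠ      = ⊥ᶠ
sub σ ⊤ᶠ      = ⊤ᶠ

x₀ y₀ z₀ : Fm
x₀ = var 0
y₀ = var 1
z₀ = var 2

data EqMN (m n : ℕ) : Fm → Fm → Set where
  ∨-comm   : EqMN m n (x₀ ∨ y₀) (y₀ ∨ x₀)
  ∧-comm   : EqMN m n (x₀ ∧ y₀) (y₀ ∧ x₀)
  ∨-assoc  : EqMN m n (x₀ ∨ (y₀ ∨ z₀)) ((x₀ ∨ y₀) ∨ z₀)
  ∧-assoc  : EqMN m n (x₀ ∧ (y₀ ∧ z₀)) ((x₀ ∧ y₀) ∧ z₀)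
  ∨-idem   : EqMN m n (x₀ ∨ x₀) x₀
  ∧-idem   : EqMN m n (x₀ ∧ x₀) x₀
  ∨-absorb : EqMN m n (x₀ ∨ (x₀ ∧ y₀)) x₀
  ∧-absorb : EqMN m n (x₀ ∧ (x₀ ∨ y₀)) x₀
  ∧-bot    : EqMN m n (x₀ ∧ ⊥ᶠ) ⊥ᶠ
  ∨-top    : EqMN m n (x₀ ∨ ⊤ᶠ) ⊤ᶠ
  distrib  : EqMN m n (x₀ ∧ (y₀ ∨ z₀)) ((x₀ ∧ y₀) ∨ (x₀ ∧ z₀))
  ¬-bot    : EqMN m n (¬ ⊥ᶠ) ⊤ᶠ
  ¬-∨      : EqMN m n (¬ (x₀ ∨ y₀)) (¬ x₀ ∧ ¬ y₀)
  ¬-top    : EqMN m n (¬ ⊤ᶠ) ⊥ᶠ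
  ¬-∧      : EqMN m n (¬ (x₀ ∧ y₀)) (¬ x₀ ∨ ¬ y₀)
  berman   : EqMN m n (¬^ (2 * m + n) x₀) (¬^ n x₀)

record Rule : Set where
  constructor rule
  field
    arity : ℕ
    prem  : Fin arity → Fm
    concl : Fm
open Rule public

unary : Fm → Fm → Rule
unary φ ψ = rule 1 (λ _ → φ) ψ

data RAnd (m n : ℕ) : Fm → Fm → Set where
  eq→ : ∀ {φ ψ} → EqMN m n φ ψ → RAnd m n φ ψ
  eq← : ∀ {φ ψ} → EqMN m n φ ψ → RAnd m n ψ φ
  ∧-elimˡ : RAnd m n (var 0 ∧ var 1) (var 0)
  ∧-elimʳ : RAnd m n (var 0 ∧ var 1) (var 1)

isEven : ℕ → Bool
isEven zero          = true
isEven (suc zero)    = false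
isEven (suc (suc k)) = isEven k

-- fresh variable t: all rules of R^{mn}_∧ only use variables 0,1,2
tᶠ : Fm
tᶠ = var 3

sRule : ℕ → Fm → Fm → Rule
sRule k φ ψ =
  if isEven k then unary (¬^ k φ ∨ tᶠ) (¬^ k ψ ∨ tᶠ)
              else unary (¬^ k ψ ∨ tᶠ) (¬^ k φ ∨ tᶠ)

adjunction : Rule
adjunction = rule 2 pr (var 0 ∧ var 1)
  where
  pr : Fin 2 → Fm
  pr fzero        = var 0
  pr (fsuc fzero) = var 1

data O (m n : ℕ) : Rule → Set where
  base  : ∀ {φ ψ} → RAnd m n φ ψ → O m n (unary φ ψ)
  shift : ∀ {φ ψ} i → i ≤ 2 * m + n → RAnd m n φ ψ → O m n (sRule i φ ψ)
  adj   : O m n adjunction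

topAxiom : Rule
topAxiom = rule 0 (λ ()) ⊤ᶠ

O⊤ : ℕ → ℕ → Rule → Set
O⊤ m n r = O m n r ⊎ (r ≡ topAxiom)

data _⊢[_]_ (Γ : Fm → Set) (R : Rule → Set) : Fm → Set where
  hyp : ∀ {φ} → Γ φ → Γ ⊢[ R ] φ
  app : (r : Rule) → R r → (σ : ℕ → Fm) →
        ((i : Fin (arity r)) → Γ ⊢[ R ] sub σ (prem r i)) →
        Γ ⊢[ R ] sub σ (concl r)

record OckhamAlgebra : Set₁ where
  infixr 6 _⊓_
  infixr 5 _⊔'_
  infix 4 _≈_
  field
    Carrier : Set
    _≈_     : Carrier → Carrier → Set
    isEquiv : IsEquivalence _≈_
    _⊓_     : Carrier → Carrier → Carrier
    _⊔'_    : Carrier → Carrier → Carrier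
    ∼       : Carrier → Carrier
    bot top : Carrier
    ⊓-cong  : ∀ {a a' b b'} → a ≈ a' → b ≈ b' → a ⊓ b ≈ a' ⊓ b'
    ⊔-cong  : ∀ {a a' b b'} → a ≈ a' → b ≈ b' → a ⊔' b ≈ a' ⊔' b'
    ∼-cong  : ∀ {a a'} → a ≈ a' → ∼ a ≈ ∼ a'
    ⊔-comm   : ∀ x y → x ⊔' y ≈ y ⊔' x
    ⊓-comm   : ∀ x y → x ⊓ y ≈ y ⊓ x
    ⊔-assoc  : ∀ x y z → x ⊔' (y ⊔' z) ≈ (x ⊔' y) ⊔' z
    ⊓-assoc  : ∀ x y z → x ⊓ (y ⊓ z) ≈ (x ⊓ y) ⊓ z
    ⊔-idem   : ∀ x → x ⊔' x ≈ x
    ⊓-idem   : ∀ x → x ⊓ x ≈ x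
    ⊔-absorb : ∀ x y → x ⊔' (x ⊓ y) ≈ x
    ⊓-absorb : ∀ x y → x ⊓ (x ⊔' y) ≈ x
    ⊓-bot    : ∀ x → x ⊓ bot ≈ bot
    ⊔-top    : ∀ x → x ⊔' top ≈ top
    Adistrib  : ∀ x y z → x ⊓ (y ⊔' z) ≈ (x ⊓ y) ⊔' (x ⊓ z)
    ∼-bot : ∼ bot ≈ top
    ∼-⊔   : ∀ x y → ∼ (x ⊔' y) ≈ ∼ x ⊓ ∼ y
    ∼-top : ∼ top ≈ bot
    ∼-⊓   : ∀ x y → ∼ (x ⊓ y) ≈ ∼ x ⊔' ∼ y

  ∼^ : ℕ → Carrier → Carrier
  ∼^ zero    a = a
  ∼^ (suc k) a = ∼ (∼^ k a)

  _≤ᴬ_ : Carrier → Carrier → Set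
  a ≤ᴬ b = a ⊓ b ≈ a

  eval : (ℕ → Carrier) → Fm → Carrier
  eval v (var x) = v x
  eval v (φ ∧ ψ) = eval v φ ⊓ eval v ψ
  eval v (φ ∨ ψ) = eval v φ ⊔' eval v ψ
  eval v (¬ φ)   = ∼ (eval v φ)
  eval v ⊥ᶠ      = bot
  eval v ⊤ᶠ      = top

  record IsFilter (F : Carrier → Set) : Set where
    field
      nonempty : ∃ F
      up-closed : ∀ {a b} → F a → a ≤ᴬ b → F b
      meet-closed : ∀ {a b} → F a → F b → F (a ⊓ b)

InBerman : ℕ → ℕ → OckhamAlgebra → Set
InBerman m n A = ∀ a → ∼^ (2 * m + n) a ≈ ∼^ n a
  where open OckhamAlgebra A

_⊨≤[_,_]_ : (Fm → Set) → ℕ → ℕ → Fm → Set₁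
Γ ⊨≤[ m , n ] φ =
  (A : OckhamAlgebra) → InBerman m n A →
  let open OckhamAlgebra A in
  (F : Carrier → Set) → IsFilter F → (v : ℕ → Carrier) →
  (∀ γ → Γ γ → F (eval v γ)) → F (eval v φ)

{-# OPTIONS --safe #-}
-- Soundness: each rule of O^m_n keeps a valuation inside a lattice filter, because ¬^k is
-- monotone for even k and antitone for odd k, and _⊔ t is monotone.
-- Completeness: identify a and b when ¬^k a ∨ t and ¬^k b ∨ t are interderivable for all k
-- and t. The shifted rules give this for instances of the equations at the levels k ≤ 2m+n,
-- the Berman equation (applied at level 0) brings every higher level down since n < 2m+n, and
-- compatibility with ∧ and ∨ is proved by induction on k, De Morgan exchanging the two
-- connectives at each step. The quotient is an algebra in O^m_n in which the theorems of Γ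
-- form a filter, and the identity valuation refutes every underivable φ.
module Submission where

open import Defs
open import Data.Nat using (ℕ; zero; suc; _+_; _*_; _≤_; _<_; z≤n; _≤?_)
open import Data.Nat.Properties using (≤-trans; m≤m+n; m<n+m; +-monoˡ-<; ≰⇒>; <⇒≤; m≤n⇒∃[o]m+o≡n)
open import Data.Nat.Induction using (<-rec)
open import Data.Fin using () renaming (zero to fzero; suc to fsuc)
open import Data.Bool using (true; false; if_then_else_)
open import Data.Product using (_×_; _,_; proj₁; proj₂; swap)
open import Data.Sum using (inj₁; inj₂)
open import Function.Base using (_∘_)
open import Function.Bundles using (_⇔_; mk⇔)
open import Relation.Nullary using (yes; no)
open import Relation.Binary.Bundles using (Setoid)
open import Relation.Binary.Structures using (IsEquivalence)
open import Relation.Binary.PropositionalEquality using (_≡_; refl; sym; trans; cong; cong₂; subst; subst₂)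
import Relation.Binary.Reasoning.Setoid as SetoidReasoning
import Relation.Binary.Reasoning.Base.Single as SingleRelationReasoning

sub-¬^ : ∀ k σ φ → sub σ (¬^ k φ) ≡ ¬^ k (sub σ φ)
sub-¬^ zero    σ φ = refl
sub-¬^ (suc k) σ φ = cong ¬_ (sub-¬^ k σ φ)

¬^-+ : ∀ i j φ → ¬^ (i + j) φ ≡ ¬^ i (¬^ j φ)
¬^-+ zero    j φ = refl
¬^-+ (suc i) j φ = cong ¬_ (¬^-+ i j φ)

¬^-¬ : ∀ k φ → ¬^ k (¬ φ) ≡ ¬ (¬^ k φ)
¬^-¬ zero    φ = refl
¬^-¬ (suc k) φ = cong ¬_ (¬^-¬ k φ)

-- Position 3 instantiates the fresh variable tᶠ of the shifted rules.
⟪_,_,_,_⟫ : Fm → Fm → Fm → Fm → ℕ → Fm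
⟪ a , b , c , t ⟫ 0 = a
⟪ a , b , c , t ⟫ 1 = b
⟪ a , b , c , t ⟫ 2 = c
⟪ a , b , c , t ⟫ 3 = t
⟪ a , b , c , t ⟫ x = var x

module Soundness {m n : ℕ} (A : OckhamAlgebra) (A-berman : InBerman m n A) where
  open OckhamAlgebra A
  open IsEquivalence isEquiv using () renaming (refl to ≈-refl; sym to ≈-sym)

  ≈-setoid : Setoid _ _
  ≈-setoid = record { isEquivalence = isEquiv }

  open SetoidReasoning ≈-setoid

  -- The lattice order in its join form, which is the convenient one for ⊔-monotonicity.
  infix 4 _≼_
  _≼_ : Carrier → Carrier → Set
  a ≼ b = a ⊔' b ≈ b

  ≤ᴬ⇒≼ : ∀ {a b} → a ≤ᴬ b → a ≼ b
  ≤ᴬ⇒≼ {a} {b} a⊓b≈a = begin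
    a ⊔' b        ≈⟨ ⊔-cong a⊓b≈a ≈-refl ⟨
    a ⊓ b ⊔' b    ≈⟨ ⊔-comm (a ⊓ b) b ⟩
    b ⊔' a ⊓ b    ≈⟨ ⊔-cong ≈-refl (⊓-comm a b) ⟩
    b ⊔' b ⊓ a    ≈⟨ ⊔-absorb b a ⟩
    b             ∎

  ≼⇒≤ᴬ : ∀ {a b} → a ≼ b → a ≤ᴬ b
  ≼⇒≤ᴬ {a} {b} a⊔b≈b = begin
    a ⊓ b         ≈⟨ ⊓-cong ≈-refl a⊔b≈b ⟨
    a ⊓ (a ⊔' b)  ≈⟨ ⊓-absorb a b ⟩
    a             ∎

  ≈⇒≼ : ∀ {a b} → a ≈ b → a ≼ b
  ≈⇒≼ {a} {b} a≈b = begin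
    a ⊔' b  ≈⟨ ⊔-cong a≈b ≈-refl ⟩
    b ⊔' b  ≈⟨ ⊔-idem b ⟩
    b       ∎

  ⊓-≼ˡ : ∀ a b → a ⊓ b ≼ a
  ⊓-≼ˡ a b = begin
    a ⊓ b ⊔' a  ≈⟨ ⊔-comm (a ⊓ b) a ⟩
    a ⊔' a ⊓ b  ≈⟨ ⊔-absorb a b ⟩
    a           ∎

  ⊓-≼ʳ : ∀ a b → a ⊓ b ≼ b
  ⊓-≼ʳ a b = begin
    a ⊓ b ⊔' b  ≈⟨ ⊔-cong (⊓-comm a b) ≈-refl ⟩
    b ⊓ a ⊔' b  ≈⟨ ⊓-≼ˡ b a ⟩
    b           ∎

  ⊔-monoˡ-≼ : ∀ {a b} t → a ≼ b → a ⊔' t ≼ b ⊔' t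
  ⊔-monoˡ-≼ {a} {b} t a⊔b≈b = begin
    (a ⊔' t) ⊔' (b ⊔' t)  ≈⟨ ⊔-assoc a t (b ⊔' t) ⟨
    a ⊔' (t ⊔' (b ⊔' t))  ≈⟨ ⊔-cong ≈-refl (⊔-comm t (b ⊔' t)) ⟩
    a ⊔' ((b ⊔' t) ⊔' t)  ≈⟨ ⊔-cong ≈-refl (⊔-assoc b t t) ⟨
    a ⊔' (b ⊔' (t ⊔' t))  ≈⟨ ⊔-cong ≈-refl (⊔-cong ≈-refl (⊔-idem t)) ⟩
    a ⊔' (b ⊔' t)         ≈⟨ ⊔-assoc a b t ⟩
    (a ⊔' b) ⊔' t         ≈⟨ ⊔-cong a⊔b≈b ≈-refl ⟩
    b ⊔' t                ∎

  ∼-antitone : ∀ {a b} → a ≼ b → ∼ b ≼ ∼ a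
  ∼-antitone {a} {b} a⊔b≈b = ≤ᴬ⇒≼ (begin
    ∼ b ⊓ ∼ a     ≈⟨ ⊓-comm (∼ b) (∼ a) ⟩
    ∼ a ⊓ ∼ b     ≈⟨ ∼-⊔ a b ⟨
    ∼ (a ⊔' b)    ≈⟨ ∼-cong a⊔b≈b ⟩
    ∼ b           ∎)

  ∼^-mono : ∀ k {a b} → a ≼ b → if isEven k then ∼^ k a ≼ ∼^ k b else ∼^ k b ≼ ∼^ k a
  ∼^-mono zero          a≼b = a≼b
  ∼^-mono (suc zero)    a≼b = ∼-antitone a≼b
  ∼^-mono (suc (suc k)) a≼b with isEven k | ∼^-mono k a≼b
  ... | true  | ∼^ka≼∼^kb = ∼-antitone (∼-antitone ∼^ka≼∼^kb)
  ... | false | ∼^kb≼∼^ka = ∼-antitone (∼-antitone ∼^kb≼∼^ka)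

  eval-¬^ : ∀ k w φ → eval w (¬^ k φ) ≡ ∼^ k (eval w φ)
  eval-¬^ zero    w φ = refl
  eval-¬^ (suc k) w φ = cong ∼ (eval-¬^ k w φ)

  eval-sub : ∀ v σ φ → eval v (sub σ φ) ≡ eval (λ x → eval v (σ x)) φ
  eval-sub v σ (var x) = refl
  eval-sub v σ (φ ∧ ψ) = cong₂ _⊓_ (eval-sub v σ φ) (eval-sub v σ ψ)
  eval-sub v σ (φ ∨ ψ) = cong₂ _⊔'_ (eval-sub v σ φ) (eval-sub v σ ψ)
  eval-sub v σ (¬ φ)   = cong ∼ (eval-sub v σ φ)
  eval-sub v σ ⊥ᶠ      = refl
  eval-sub v σ ⊤ᶠ      = refl

  EqMN-valid : ∀ {φ ψ} → EqMN m n φ ψ → ∀ w → eval w φ ≈ eval w ψ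
  EqMN-valid ∨-comm   w = ⊔-comm _ _
  EqMN-valid ∧-comm   w = ⊓-comm _ _
  EqMN-valid ∨-assoc  w = ⊔-assoc _ _ _
  EqMN-valid ∧-assoc  w = ⊓-assoc _ _ _
  EqMN-valid ∨-idem   w = ⊔-idem _
  EqMN-valid ∧-idem   w = ⊓-idem _
  EqMN-valid ∨-absorb w = ⊔-absorb _ _
  EqMN-valid ∧-absorb w = ⊓-absorb _ _
  EqMN-valid ∧-bot    w = ⊓-bot _
  EqMN-valid ∨-top    w = ⊔-top _
  EqMN-valid distrib  w = Adistrib _ _ _
  EqMN-valid ¬-bot    w = ∼-bot
  EqMN-valid ¬-∨      w = ∼-⊔ _ _
  EqMN-valid ¬-top    w = ∼-top
  EqMN-valid ¬-∧      w = ∼-⊓ _ _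
  EqMN-valid berman   w =
    subst₂ _≈_ (sym (eval-¬^ (2 * m + n) w x₀)) (sym (eval-¬^ n w x₀)) (A-berman (w 0))

  RAnd-valid : ∀ {φ ψ} → RAnd m n φ ψ → ∀ w → eval w φ ≼ eval w ψ
  RAnd-valid (eq→ e) w = ≈⇒≼ (EqMN-valid e w)
  RAnd-valid (eq← e) w = ≈⇒≼ (≈-sym (EqMN-valid e w))
  RAnd-valid ∧-elimˡ w = ⊓-≼ˡ _ _
  RAnd-valid ∧-elimʳ w = ⊓-≼ʳ _ _

  ¬^-∨-≼ : ∀ k w {χ χ'} → ∼^ k (eval w χ) ≼ ∼^ k (eval w χ') →
           eval w (¬^ k χ ∨ tᶠ) ≼ eval w (¬^ k χ' ∨ tᶠ)
  ¬^-∨-≼ k w {χ} {χ'} =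
    subst₂ (λ a b → a ⊔' w 3 ≼ b ⊔' w 3) (sym (eval-¬^ k w χ)) (sym (eval-¬^ k w χ'))
      ∘ ⊔-monoˡ-≼ (w 3)

  module _ {F : Carrier → Set} (F-filter : IsFilter F) where
    open IsFilter F-filter

    ≼-closed : ∀ {a b} → F a → a ≼ b → F b
    ≼-closed Fa a≼b = up-closed Fa (≼⇒≤ᴬ a≼b)

    O-valid : ∀ {r} → O m n r → ∀ w → (∀ i → F (eval w (prem r i))) → F (eval w (concl r))
    O-valid (base r) w Fprem = ≼-closed (Fprem fzero) (RAnd-valid r w)
    O-valid adj      w Fprem = meet-closed (Fprem fzero) (Fprem (fsuc fzero))
    O-valid (shift k _ r) w Fprem with isEven k | ∼^-mono k (RAnd-valid r w)
    ... | true  | ordered = ≼-closed (Fprem fzero) (¬^-∨-≼ k w ordered)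
    ... | false | ordered = ≼-closed (Fprem fzero) (¬^-∨-≼ k w ordered)

    sound : ∀ {Γ v φ} → (∀ γ → Γ γ → F (eval v γ)) → Γ ⊢[ O⊤ m n ] φ → F (eval v φ)
    sound FΓ (hyp γ) = FΓ _ γ
    sound FΓ (app _ (inj₂ refl) _ _) = ≼-closed (proj₂ nonempty) (⊔-top _)
    sound {v = v} FΓ (app r (inj₁ o) σ ⊢prem) =
      subst F (sym (eval-sub v σ (concl r)))
        (O-valid o _ (λ i → subst F (eval-sub v σ (prem r i)) (sound FΓ (⊢prem i))))

⊢-cut : ∀ {R Γ Δ φ} → (∀ {ψ} → Δ ψ → Γ ⊢[ R ] ψ) → Δ ⊢[ R ] φ → Γ ⊢[ R ] φ
⊢-cut ⊢Δ (hyp δ)             = ⊢Δ δ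
⊢-cut ⊢Δ (app r r∈R σ ⊢prem) = app r r∈R σ (λ i → ⊢-cut ⊢Δ (⊢prem i))

module Completeness (m n : ℕ) (1≤m : 1 ≤ m) where

  N : ℕ
  N = 2 * m + n

  n<N : n < N
  n<N = m<n+m n (≤-trans 1≤m (m≤m+n m (m + 0)))

  infix 4 _▷_ _⊑[_]_ _⊑_ _≋_

  _▷_ : Fm → Fm → Set
  a ▷ b = (_≡ a) ⊢[ O⊤ m n ] b

  ▷-refl : ∀ {a} → a ▷ a
  ▷-refl = hyp refl

  ⊢-▷ : ∀ {Γ a b} → Γ ⊢[ O⊤ m n ] a → a ▷ b → Γ ⊢[ O⊤ m n ] b
  ⊢-▷ ⊢a = ⊢-cut λ { refl → ⊢a }

  ▷-trans : ∀ {a b c} → a ▷ b → b ▷ c → a ▷ c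
  ▷-trans = ⊢-▷

  open SingleRelationReasoning _▷_ ▷-refl ▷-trans

  ⊢-∧ : ∀ {Γ a b} → Γ ⊢[ O⊤ m n ] a → Γ ⊢[ O⊤ m n ] b → Γ ⊢[ O⊤ m n ] (a ∧ b)
  ⊢-∧ {a = a} {b} ⊢a ⊢b =
    app adjunction (inj₁ adj) ⟪ a , b , ⊥ᶠ , ⊥ᶠ ⟫ λ { fzero → ⊢a ; (fsuc fzero) → ⊢b }

  rule▷ : ∀ {φ ψ} → RAnd m n φ ψ → ∀ σ → sub σ φ ▷ sub σ ψ
  rule▷ r σ = app (unary _ _) (inj₁ (base r)) σ λ _ → ▷-refl

  rule▷-∨ : ∀ {φ ψ} → RAnd m n φ ψ → ∀ σ → sub σ φ ∨ σ 3 ▷ sub σ ψ ∨ σ 3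
  rule▷-∨ r σ = app (sRule 0 _ _) (inj₁ (shift 0 z≤n r)) σ λ _ → ▷-refl

  shift▷ : ∀ {φ ψ} k → k ≤ N → RAnd m n φ ψ → ∀ σ →
           if isEven k then sub σ (¬^ k φ ∨ tᶠ) ▷ sub σ (¬^ k ψ ∨ tᶠ)
                       else sub σ (¬^ k ψ ∨ tᶠ) ▷ sub σ (¬^ k φ ∨ tᶠ)
  shift▷ k k≤N r σ with isEven k | shift k k≤N r
  ... | true  | s = app _ (inj₁ s) σ λ _ → ▷-refl
  ... | false | s = app _ (inj₁ s) σ λ _ → ▷-refl

  -- With the rule available in both directions, the parity of k no longer matters.
  reversible▷ : ∀ {φ ψ} → RAnd m n φ ψ → RAnd m n ψ φ → ∀ {k} → k ≤ N → ∀ a b c t →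
                ¬^ k (sub ⟪ a , b , c , t ⟫ φ) ∨ t ▷ ¬^ k (sub ⟪ a , b , c , t ⟫ ψ) ∨ t
  reversible▷ {φ} {ψ} r r˘ {k} k≤N a b c t =
    subst₂ _▷_ (cong (_∨ t) (sub-¬^ k σ φ)) (cong (_∨ t) (sub-¬^ k σ ψ)) shifted
    where
    σ = ⟪ a , b , c , t ⟫
    shifted : sub σ (¬^ k φ ∨ tᶠ) ▷ sub σ (¬^ k ψ ∨ tᶠ)
    shifted with isEven k | shift▷ k k≤N r σ | shift▷ k k≤N r˘ σ
    ... | true  | φ▷ψ | _   = φ▷ψ
    ... | false | _   | φ▷ψ = φ▷ψ

  _⊑[_]_ : Fm → ℕ → Fm → Set
  a ⊑[ k ] b = ∀ t → ¬^ k a ∨ t ▷ ¬^ k b ∨ t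

  _⊑_ : Fm → Fm → Set
  a ⊑ b = ∀ k → a ⊑[ k ] b

  _≋_ : Fm → Fm → Set
  a ≋ b = a ⊑ b × b ⊑ a

  ⊑[]-trans : ∀ {k a b c} → a ⊑[ k ] b → b ⊑[ k ] c → a ⊑[ k ] c
  ⊑[]-trans a⊑b b⊑c t = ▷-trans (a⊑b t) (b⊑c t)

  ≋-refl : ∀ {a} → a ≋ a
  ≋-refl = (λ _ _ → ▷-refl) , (λ _ _ → ▷-refl)

  ≋-sym : ∀ {a b} → a ≋ b → b ≋ a
  ≋-sym (a⊑b , b⊑a) = b⊑a , a⊑b

  ≋-trans : ∀ {a b c} → a ≋ b → b ≋ c → a ≋ c
  ≋-trans (a⊑b , b⊑a) (b⊑c , c⊑b) =
    (λ k → ⊑[]-trans {k} (a⊑b k) (b⊑c k)) , (λ k → ⊑[]-trans {k} (c⊑b k) (b⊑a k))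

  ⊑[suc]-intro : ∀ {k a b} → ¬ a ⊑[ k ] ¬ b → a ⊑[ suc k ] b
  ⊑[suc]-intro {k} {a} {b} ¬a⊑¬b t =
    subst₂ _▷_ (cong (_∨ t) (¬^-¬ k a)) (cong (_∨ t) (¬^-¬ k b)) (¬a⊑¬b t)

  ⊑-¬ : ∀ {a b} → a ⊑ b → ¬ a ⊑ ¬ b
  ⊑-¬ {a} {b} a⊑b k t =
    subst₂ _▷_ (cong (_∨ t) (sym (¬^-¬ k a))) (cong (_∨ t) (sym (¬^-¬ k b))) (a⊑b (suc k) t)

  -- The shifted rules only reach level N; the Berman equation at level 0 brings any level
  -- above N down by 2m.
  ⊑-from-bounded : ∀ {a b} → (∀ {k} → k ≤ N → a ⊑[ k ] b) → a ⊑ b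
  ⊑-from-bounded {a} {b} bounded = <-rec (λ k → a ⊑[ k ] b) step
    where
    berman▷ : ∀ {K K'} → RAnd m n (¬^ K x₀) (¬^ K' x₀) → ∀ j c t → ¬^ (K + j) c ∨ t ▷ ¬^ (K' + j) c ∨ t
    berman▷ {K} {K'} r j c t =
      subst₂ _▷_ (cong (_∨ t) (instance-¬^ K)) (cong (_∨ t) (instance-¬^ K'))
        (rule▷-∨ r ⟪ ¬^ j c , ⊥ᶠ , ⊥ᶠ , t ⟫)
      where
      instance-¬^ : ∀ K → sub ⟪ ¬^ j c , ⊥ᶠ , ⊥ᶠ , t ⟫ (¬^ K x₀) ≡ ¬^ (K + j) c
      instance-¬^ K = trans (sub-¬^ K _ x₀) (sym (¬^-+ K j c))

    step : ∀ k → (∀ {i} → i < k → a ⊑[ i ] b) → a ⊑[ k ] b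
    step k below with k ≤? N
    ... | yes k≤N = bounded k≤N
    ... | no k≰N with m≤n⇒∃[o]m+o≡n (<⇒≤ (≰⇒> k≰N))
    ...   | j , refl = λ t → begin
      ¬^ (N + j) a ∨ t  ∼⟨ berman▷ (eq→ berman) j a t ⟩
      ¬^ (n + j) a ∨ t  ∼⟨ below (+-monoˡ-< j n<N) t ⟩
      ¬^ (n + j) b ∨ t  ∼⟨ berman▷ (eq← berman) j b t ⟩
      ¬^ (N + j) b ∨ t  ∎

  EqMN-t-fresh : ∀ {φ ψ} → EqMN m n φ ψ → ∀ {a b c} t →
                 sub ⟪ a , b , c , t ⟫ φ ≡ sub ⟪ a , b , c , ⊥ᶠ ⟫ φ ×
                 sub ⟪ a , b , c , t ⟫ ψ ≡ sub ⟪ a , b , c , ⊥ᶠ ⟫ ψ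
  EqMN-t-fresh ∨-comm   _ = refl , refl
  EqMN-t-fresh ∧-comm   _ = refl , refl
  EqMN-t-fresh ∨-assoc  _ = refl , refl
  EqMN-t-fresh ∧-assoc  _ = refl , refl
  EqMN-t-fresh ∨-idem   _ = refl , refl
  EqMN-t-fresh ∧-idem   _ = refl , refl
  EqMN-t-fresh ∨-absorb _ = refl , refl
  EqMN-t-fresh ∧-absorb _ = refl , refl
  EqMN-t-fresh ∧-bot    _ = refl , refl
  EqMN-t-fresh ∨-top    _ = refl , refl
  EqMN-t-fresh distrib  _ = refl , refl
  EqMN-t-fresh ¬-bot    _ = refl , refl
  EqMN-t-fresh ¬-∨      _ = refl , refl
  EqMN-t-fresh ¬-top    _ = refl , refl
  EqMN-t-fresh ¬-∧      _ = refl , refl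
  EqMN-t-fresh berman {a} {b} {c} t = ¬^-x₀ N , ¬^-x₀ n
    where
    ¬^-x₀ : ∀ K → sub ⟪ a , b , c , t ⟫ (¬^ K x₀) ≡ sub ⟪ a , b , c , ⊥ᶠ ⟫ (¬^ K x₀)
    ¬^-x₀ K = trans (sub-¬^ K _ x₀) (sym (sub-¬^ K _ x₀))

  EqMN-≋ : ∀ {φ ψ} → EqMN m n φ ψ → ∀ a b c →
           sub ⟪ a , b , c , ⊥ᶠ ⟫ φ ≋ sub ⟪ a , b , c , ⊥ᶠ ⟫ ψ
  EqMN-≋ {φ} {ψ} e a b c =
    ⊑-from-bounded (instance-⊑ (eq→ e) (eq← e) (EqMN-t-fresh e)) ,
    ⊑-from-bounded (instance-⊑ (eq← e) (eq→ e) (swap ∘ EqMN-t-fresh e))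
    where
    instance-⊑ : ∀ {χ χ'} → RAnd m n χ χ' → RAnd m n χ' χ →
                 (∀ t → sub ⟪ a , b , c , t ⟫ χ ≡ sub ⟪ a , b , c , ⊥ᶠ ⟫ χ ×
                        sub ⟪ a , b , c , t ⟫ χ' ≡ sub ⟪ a , b , c , ⊥ᶠ ⟫ χ') →
                 ∀ {k} → k ≤ N → sub ⟪ a , b , c , ⊥ᶠ ⟫ χ ⊑[ k ] sub ⟪ a , b , c , ⊥ᶠ ⟫ χ'
    instance-⊑ r r˘ fresh {k} k≤N t =
      subst₂ (λ d d' → ¬^ k d ∨ t ▷ ¬^ k d' ∨ t) (proj₁ (fresh t)) (proj₂ (fresh t))
        (reversible▷ r r˘ k≤N a b c t)

  ∨-comm▷ : ∀ a b → a ∨ b ▷ b ∨ a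
  ∨-comm▷ a b = rule▷ (eq→ ∨-comm) ⟪ a , b , ⊥ᶠ , ⊥ᶠ ⟫

  ∨-distribʳ-∧▷ : ∀ a b t → (a ∨ t) ∧ (b ∨ t) ▷ (a ∧ b) ∨ t
  ∨-distribʳ-∧▷ a b t = begin
    (a ∨ t) ∧ (b ∨ t)              ∼⟨ rule▷ (eq→ distrib) ⟪ a ∨ t , b , t , ⊥ᶠ ⟫ ⟩
    ((a ∨ t) ∧ b) ∨ ((a ∨ t) ∧ t)  ∼⟨ ∨-comm▷ _ _ ⟩
    ((a ∨ t) ∧ t) ∨ ((a ∨ t) ∧ b)  ∼⟨ rule▷-∨ ∧-elimʳ ⟪ a ∨ t , t , ⊥ᶠ , (a ∨ t) ∧ b ⟫ ⟩
    t ∨ ((a ∨ t) ∧ b)              ∼⟨ ∨-comm▷ _ _ ⟩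
    ((a ∨ t) ∧ b) ∨ t              ∼⟨ rule▷-∨ (eq→ ∧-comm) ⟪ a ∨ t , b , ⊥ᶠ , t ⟫ ⟩
    (b ∧ (a ∨ t)) ∨ t              ∼⟨ rule▷-∨ (eq→ distrib) ⟪ b , a , t , t ⟫ ⟩
    ((b ∧ a) ∨ (b ∧ t)) ∨ t        ∼⟨ rule▷ (eq← ∨-assoc) ⟪ b ∧ a , b ∧ t , t , ⊥ᶠ ⟫ ⟩
    (b ∧ a) ∨ ((b ∧ t) ∨ t)        ∼⟨ ∨-comm▷ _ _ ⟩
    ((b ∧ t) ∨ t) ∨ (b ∧ a)        ∼⟨ rule▷ (eq← ∨-assoc) ⟪ b ∧ t , t , b ∧ a , ⊥ᶠ ⟫ ⟩
    (b ∧ t) ∨ (t ∨ (b ∧ a))        ∼⟨ rule▷-∨ ∧-elimʳ ⟪ b , t , ⊥ᶠ , t ∨ (b ∧ a) ⟫ ⟩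
    t ∨ (t ∨ (b ∧ a))              ∼⟨ rule▷ (eq→ ∨-assoc) ⟪ t , t , b ∧ a , ⊥ᶠ ⟫ ⟩
    (t ∨ t) ∨ (b ∧ a)              ∼⟨ rule▷-∨ (eq→ ∨-idem) ⟪ t , ⊥ᶠ , ⊥ᶠ , b ∧ a ⟫ ⟩
    t ∨ (b ∧ a)                    ∼⟨ ∨-comm▷ _ _ ⟩
    (b ∧ a) ∨ t                    ∼⟨ rule▷-∨ (eq→ ∧-comm) ⟪ b , a , ⊥ᶠ , t ⟫ ⟩
    (a ∧ b) ∨ t                    ∎

  ⊑₀-∨-congˡ : ∀ {a a'} → a ⊑[ 0 ] a' → ∀ b → a ∨ b ⊑[ 0 ] a' ∨ b
  ⊑₀-∨-congˡ {a} {a'} a⊑a' b t = begin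
    (a ∨ b) ∨ t   ∼⟨ rule▷ (eq← ∨-assoc) ⟪ a , b , t , ⊥ᶠ ⟫ ⟩
    a ∨ (b ∨ t)   ∼⟨ a⊑a' (b ∨ t) ⟩
    a' ∨ (b ∨ t)  ∼⟨ rule▷ (eq→ ∨-assoc) ⟪ a' , b , t , ⊥ᶠ ⟫ ⟩
    (a' ∨ b) ∨ t  ∎

  ⊑₀-∧-congˡ : ∀ {a a'} → a ⊑[ 0 ] a' → ∀ b → a ∧ b ⊑[ 0 ] a' ∧ b
  ⊑₀-∧-congˡ {a} {a'} a⊑a' b t = begin
    (a ∧ b) ∨ t          ∼⟨ ⊢-∧ (▷-trans (rule▷-∨ ∧-elimˡ σ) (a⊑a' t)) (rule▷-∨ ∧-elimʳ σ) ⟩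
    (a' ∨ t) ∧ (b ∨ t)   ∼⟨ ∨-distribʳ-∧▷ a' b t ⟩
    (a' ∧ b) ∨ t         ∎
    where σ = ⟪ a , b , ⊥ᶠ , t ⟫

  -- Induction on the level, with ¬ turning ∨ into ∧ and back (De Morgan), so both are proved together.
  ⊑-∨-∧-congˡ : ∀ k {a a'} → a ⊑ a' → ∀ b → (a ∨ b ⊑[ k ] a' ∨ b) × (a ∧ b ⊑[ k ] a' ∧ b)
  ⊑-∨-∧-congˡ zero    a⊑a' b = ⊑₀-∨-congˡ (a⊑a' 0) b , ⊑₀-∧-congˡ (a⊑a' 0) b
  ⊑-∨-∧-congˡ (suc k) {a} {a'} a⊑a' b =
    ⊑[suc]-intro (de-Morgan ¬-∨ (proj₂ ih)) , ⊑[suc]-intro (de-Morgan ¬-∧ (proj₁ ih))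
    where
    ih : (¬ a ∨ ¬ b ⊑[ k ] ¬ a' ∨ ¬ b) × (¬ a ∧ ¬ b ⊑[ k ] ¬ a' ∧ ¬ b)
    ih = ⊑-∨-∧-congˡ k (⊑-¬ a⊑a') (¬ b)
    de-Morgan : ∀ {φ ψ} → EqMN m n (¬ φ) ψ →
                sub ⟪ a , b , ⊥ᶠ , ⊥ᶠ ⟫ ψ ⊑[ k ] sub ⟪ a' , b , ⊥ᶠ , ⊥ᶠ ⟫ ψ →
                ¬ sub ⟪ a , b , ⊥ᶠ , ⊥ᶠ ⟫ φ ⊑[ k ] ¬ sub ⟪ a' , b , ⊥ᶠ , ⊥ᶠ ⟫ φ
    de-Morgan e inner = ⊑[]-trans {k} (proj₁ (EqMN-≋ e a b ⊥ᶠ) k)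
                          (⊑[]-trans {k} inner (proj₂ (EqMN-≋ e a' b ⊥ᶠ) k))

  ≋-∨-congˡ : ∀ {a a'} → a ≋ a' → ∀ b → a ∨ b ≋ a' ∨ b
  ≋-∨-congˡ (a⊑a' , a'⊑a) b =
    (λ k → proj₁ (⊑-∨-∧-congˡ k a⊑a' b)) , (λ k → proj₁ (⊑-∨-∧-congˡ k a'⊑a b))

  ≋-∧-congˡ : ∀ {a a'} → a ≋ a' → ∀ b → a ∧ b ≋ a' ∧ b
  ≋-∧-congˡ (a⊑a' , a'⊑a) b =
    (λ k → proj₂ (⊑-∨-∧-congˡ k a⊑a' b)) , (λ k → proj₂ (⊑-∨-∧-congˡ k a'⊑a b))

  ≋-∨-cong : ∀ {a a' b b'} → a ≋ a' → b ≋ b' → a ∨ b ≋ a' ∨ b'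
  ≋-∨-cong {a' = a'} {b} {b'} a≋a' b≋b' =
    ≋-trans (≋-∨-congˡ a≋a' b) (≋-trans (EqMN-≋ ∨-comm a' b ⊥ᶠ)
      (≋-trans (≋-∨-congˡ b≋b' a') (EqMN-≋ ∨-comm b' a' ⊥ᶠ)))

  ≋-∧-cong : ∀ {a a' b b'} → a ≋ a' → b ≋ b' → a ∧ b ≋ a' ∧ b'
  ≋-∧-cong {a' = a'} {b} {b'} a≋a' b≋b' =
    ≋-trans (≋-∧-congˡ a≋a' b) (≋-trans (EqMN-≋ ∧-comm a' b ⊥ᶠ)
      (≋-trans (≋-∧-congˡ b≋b' a') (EqMN-≋ ∧-comm b' a' ⊥ᶠ)))

  ≋-¬-cong : ∀ {a a'} → a ≋ a' → ¬ a ≋ ¬ a'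
  ≋-¬-cong (a⊑a' , a'⊑a) = ⊑-¬ a⊑a' , ⊑-¬ a'⊑a

  Lindenbaum : OckhamAlgebra
  Lindenbaum = record
    { Carrier  = Fm
    ; _≈_      = _≋_
    ; isEquiv  = record { refl = ≋-refl ; sym = ≋-sym ; trans = ≋-trans }
    ; _⊓_      = _∧_
    ; _⊔'_     = _∨_
    ; ∼        = ¬_
    ; bot      = ⊥ᶠ
    ; top      = ⊤ᶠ
    ; ⊓-cong   = ≋-∧-cong
    ; ⊔-cong   = ≋-∨-cong
    ; ∼-cong   = ≋-¬-cong
    ; ⊔-comm   = λ a b → EqMN-≋ ∨-comm a b ⊥ᶠ
    ; ⊓-comm   = λ a b → EqMN-≋ ∧-comm a b ⊥ᶠ
    ; ⊔-assoc  = EqMN-≋ ∨-assoc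
    ; ⊓-assoc  = EqMN-≋ ∧-assoc
    ; ⊔-idem   = λ a → EqMN-≋ ∨-idem a ⊥ᶠ ⊥ᶠ
    ; ⊓-idem   = λ a → EqMN-≋ ∧-idem a ⊥ᶠ ⊥ᶠ
    ; ⊔-absorb = λ a b → EqMN-≋ ∨-absorb a b ⊥ᶠ
    ; ⊓-absorb = λ a b → EqMN-≋ ∧-absorb a b ⊥ᶠ
    ; ⊓-bot    = λ a → EqMN-≋ ∧-bot a ⊥ᶠ ⊥ᶠ
    ; ⊔-top    = λ a → EqMN-≋ ∨-top a ⊥ᶠ ⊥ᶠ
    ; Adistrib = EqMN-≋ distrib
    ; ∼-bot    = EqMN-≋ ¬-bot ⊥ᶠ ⊥ᶠ ⊥ᶠ
    ; ∼-⊔      = λ a b → EqMN-≋ ¬-∨ a b ⊥ᶠ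
    ; ∼-top    = EqMN-≋ ¬-top ⊥ᶠ ⊥ᶠ ⊥ᶠ
    ; ∼-⊓      = λ a b → EqMN-≋ ¬-∧ a b ⊥ᶠ
    }

  open OckhamAlgebra Lindenbaum using (∼^; eval; IsFilter)

  ∼^≡¬^ : ∀ k a → ∼^ k a ≡ ¬^ k a
  ∼^≡¬^ zero    a = refl
  ∼^≡¬^ (suc k) a = cong ¬_ (∼^≡¬^ k a)

  Lindenbaum-berman : InBerman m n Lindenbaum
  Lindenbaum-berman a = subst₂ _≋_ (¬^-instance N) (¬^-instance n) (EqMN-≋ berman a ⊥ᶠ ⊥ᶠ)
    where
    ¬^-instance : ∀ K → sub ⟪ a , ⊥ᶠ , ⊥ᶠ , ⊥ᶠ ⟫ (¬^ K x₀) ≡ ∼^ K a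
    ¬^-instance K = trans (sub-¬^ K _ x₀) (sym (∼^≡¬^ K a))

  eval-var : ∀ φ → eval var φ ≡ φ
  eval-var (var x) = refl
  eval-var (φ ∧ ψ) = cong₂ _∧_ (eval-var φ) (eval-var ψ)
  eval-var (φ ∨ ψ) = cong₂ _∨_ (eval-var φ) (eval-var ψ)
  eval-var (¬ φ)   = cong ¬_ (eval-var φ)
  eval-var ⊥ᶠ      = refl
  eval-var ⊤ᶠ      = refl

  ⊑-▷ : ∀ {a b} → a ⊑ b → a ▷ b
  ⊑-▷ {a} {b} a⊑b = begin
    a              ∼⟨ rule▷ (eq← ∧-absorb) ⟪ a , ⊥ᶠ , ⊥ᶠ , ⊥ᶠ ⟫ ⟩
    a ∧ (a ∨ ⊥ᶠ)   ∼⟨ rule▷ ∧-elimʳ ⟪ a , a ∨ ⊥ᶠ , ⊥ᶠ , ⊥ᶠ ⟫ ⟩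
    a ∨ ⊥ᶠ         ∼⟨ a⊑b 0 ⊥ᶠ ⟩
    b ∨ ⊥ᶠ         ∼⟨ ∨-comm▷ b ⊥ᶠ ⟩
    ⊥ᶠ ∨ b         ∼⟨ rule▷-∨ (eq← ∧-bot) ⟪ b , ⊥ᶠ , ⊥ᶠ , b ⟫ ⟩
    (b ∧ ⊥ᶠ) ∨ b   ∼⟨ ∨-comm▷ (b ∧ ⊥ᶠ) b ⟩
    b ∨ (b ∧ ⊥ᶠ)   ∼⟨ rule▷ (eq→ ∨-absorb) ⟪ b , ⊥ᶠ , ⊥ᶠ , ⊥ᶠ ⟫ ⟩
    b              ∎

  theorems-filter : ∀ Γ → IsFilter (Γ ⊢[ O⊤ m n ]_)
  theorems-filter Γ = record
    { nonempty    = ⊤ᶠ , app topAxiom (inj₂ refl) var λ ()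
    ; up-closed   = λ {a} {b} ⊢a a∧b≋a →
        ⊢-▷ ⊢a (▷-trans (⊑-▷ (proj₂ a∧b≋a)) (rule▷ ∧-elimʳ ⟪ a , b , ⊥ᶠ , ⊥ᶠ ⟫))
    ; meet-closed = ⊢-∧
    }

  complete : ∀ {Γ φ} → Γ ⊨≤[ m , n ] φ → Γ ⊢[ O⊤ m n ] φ
  complete {Γ} {φ} ⊨φ =
    subst (Γ ⊢[ O⊤ m n ]_) (eval-var φ)
      (⊨φ Lindenbaum Lindenbaum-berman _ (theorems-filter Γ) var
         λ γ Γγ → subst (Γ ⊢[ O⊤ m n ]_) (sym (eval-var γ)) (hyp Γγ))

theorem5p2 : (m n : ℕ) → 1 ≤ m → (Γ : Fm → Set) → (φ : Fm) →
    (Γ ⊢[ O⊤ m n ] φ) ⇔ (Γ ⊨≤[ m , n ] φ)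
theorem5p2 m n 1≤m Γ φ = mk⇔
  (λ ⊢φ A A-berman F F-filter v FΓ → Soundness.sound A A-berman F-filter FΓ ⊢φ)
  (Completeness.complete m n 1≤m)
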